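{- Let $c_n$ be the number of walks of length $n$ starting at $(0,0)$ with steps from $\{(1,1),(1,-1),(-1,1)\}$ that stay in the quarter plane $\mathbb{N}^2$. Then $$c_n\sim\alpha\,3^n+O(8^{n/2}),\qquad \alpha=1-2\sum_{n\ge0}\frac{(-1)^n}{F_{2n+1}F_{2n+3}},$$ where $F_k$ denotes the $k$-th Fibonacci number ($F_1=F_2=1$, $F_{k}=F_{k-1}+F_{k-2}$). -}

module Defs where

open import Data.Nat as ℕ using (ℕ; zero; suc; NonZero)
open import Data.Nat.Properties using (m*n≢0)
open import Data.Integer as ℤ using (ℤ; +_; -[1+_])
open import Data.Rational using (ℚ; _/_; _+_; _-_; _*_; 1ℚ; 0ℚ)
open import Data.List using (List; []; _∷_; map; concatMap; filter; length)
open import Data.Bool using (Bool; true; false; _∧_)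
open import Relation.Nullary.Decidable using (Dec; yes; no)

data Step : Set where
  NE SE NW : Step      -- (1,1), (1,-1), (-1,1)

allSteps : List Step
allSteps = NE ∷ SE ∷ NW ∷ []

allWords : ℕ → List (List Step)
allWords zero    = [] ∷ []
allWords (suc n) = concatMap (λ s → map (s ∷_) (allWords n)) allSteps

-- does the walk with the given steps, started at (x , y) ∈ ℕ², stay in ℕ²?
-- (coordinates are kept in ℕ; a step to -1 is detected before it happens)
staysIn : ℕ → ℕ → List Step → Bool
staysIn x y []            = true
staysIn x y (NE ∷ w)      = staysIn (suc x) (suc y) w
staysIn x zero (SE ∷ w)   = false
staysIn x (suc y) (SE ∷ w) = staysIn (suc x) y w
staysIn zero y (NW ∷ w)   = false
staysIn (suc x) y (NW ∷ w) = staysIn x (suc y) w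

isQuadrantWalk : List Step → Bool
isQuadrantWalk = staysIn 0 0

c : ℕ → ℕ
c n = length (filter (λ w → dec (isQuadrantWalk w)) (allWords n))
  where
  open import Relation.Binary.PropositionalEquality using (_≡_; refl)
  open import Data.Bool using (_≟_)
  dec : (b : Bool) → Dec (b ≡ true)
  dec b = b ≟ true

F : ℕ → ℕ
F zero          = 0
F (suc zero)    = 1
F (suc (suc k)) = F (suc k) ℕ.+ F k

F-suc-nonZero : ∀ k → NonZero (F (suc k))
F-suc-nonZero zero          = _
F-suc-nonZero (suc zero)    = _
F-suc-nonZero (suc (suc k)) with F (suc (suc k)) | F-suc-nonZero (suc k)
... | suc m | _ = _

sign : ℕ → ℤ
sign zero    = + 1
sign (suc k) = ℤ.- sign k

term : ℕ → ℚ
term k = _/_ (sign k) (F (suc (2 ℕ.* k)) ℕ.* F (suc (suc (suc (2 ℕ.* k)))))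
           {{m*n≢0 _ _ {{F-suc-nonZero (2 ℕ.* k)}} {{F-suc-nonZero (suc (suc (2 ℕ.* k)))}}}}

partialSum : ℕ → ℚ
partialSum zero    = 0ℚ
partialSum (suc N) = partialSum N + term N

-- α_N = 1 - 2 Σ_{k<N} (-1)^k/(F_{2k+1}F_{2k+3});  α = lim_{N→∞} α_N
αPartial : ℕ → ℚ
αPartial N = 1ℚ - ((+ 2 / 1) * partialSum N)

ℕ→ℚ : ℕ → ℚ
ℕ→ℚ n = + n / 1

{-# OPTIONS --safe #-}
-- Summing a weight h over the endpoints of the n-step quadrant walks (walkSum) counts them
-- for h = 1.  Split 1 = H + (1 - H) with H = 1 - Σ_{k<N} (-1)^k T_k, where
-- T_k(i, j) = P_k^i P_{k+1}^j + P_k^j P_{k+1}^i and P_k = 1/F_{2k+1}.  A monomial p^i q^j is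
-- harmonic for the step set (3 H(z) = Σ_s H(z + s)) when 3pq = p²q² + p² + q², which holds for
-- consecutive P_k because consecutive odd-indexed Fibonacci numbers solve the Markov-type
-- equation a² + b² + 1 = 3ab.  On the lines just outside the quadrant the alternating sum
-- telescopes to ±P_N^i, so the walks see H as a martingale up to an error 3^n P_N → 0, and
-- H at the origin is α_N.  The rest is O(8^(n/2)) because |1 - H(x, y)| ≤ 2^-x + 2^-y.
module Submission where

open import Defs
open import Data.Nat using (ℕ; _^_; zero; suc; NonZero)
open import Data.Product using (∃-syntax; _,_; _×_)
open import Data.Rational using (ℚ; 0ℚ; 1ℚ; ½; _<_; _≤_; _+_; _-_; _*_; -_; _/_; ∣_∣; mkℚ; toℚᵘ; nonNegative)
import Data.Nat as ℕ
import Data.Nat.Properties as ℕₚ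
import Data.Integer as ℤ
import Data.Integer.Properties as ℤₚ
import Data.Rational.Properties as ℚₚ
import Data.Rational.Unnormalised as ℚᵘ
import Data.Rational.Unnormalised.Properties as ℚᵘₚ
open import Data.Bool using (Bool; true; false)
import Data.Bool as Bool
open import Data.List using (List; []; _∷_; _++_; map; filter; length)
import Data.List.Properties as Listₚ
open import Data.Maybe using (Maybe; just; nothing)
open import Data.Sum using (_⊎_; inj₁; inj₂)
open import Level using (0ℓ)
open import Relation.Nullary using (yes; no)
open import Relation.Binary.PropositionalEquality
open import Algebra.Bundles using (CommutativeMonoid)
open import Algebra.Properties.CommutativeSemigroup
  (CommutativeMonoid.commutativeSemigroup ℚₚ.*-1-commutativeMonoid) using () renaming (interchange to *-interchange)
open import Algebra.Properties.CommutativeSemigroup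
  (CommutativeMonoid.commutativeSemigroup ℚₚ.+-0-commutativeMonoid) using () renaming (xy∙z≈xz∙y to +-swapʳ)
open import Algebra.Definitions.RawSemiring Data.Rational.+-*-rawSemiring using () renaming (_^_ to _^ℚ_)
open import Tactic.RingSolver using (solve-∀; solve)
open import Tactic.RingSolver.Core.AlmostCommutativeRing using (AlmostCommutativeRing; fromCommutativeRing)
import Data.Nat.Tactic.RingSolver as ℕ-Solver

ℚ-ring : AlmostCommutativeRing 0ℓ 0ℓ
ℚ-ring = fromCommutativeRing ℚₚ.+-*-commutativeRing is-zero
  where
  is-zero : ∀ p → Maybe (0ℚ ≡ p)
  is-zero p with 0ℚ ℚₚ.≟ p
  ... | yes 0≡p = just 0≡p
  ... | no _    = nothing

toℚᵘ-/ : ∀ i d → toℚᵘ (i / suc d) ℚᵘ.≃ ℚᵘ.mkℚᵘ i d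
toℚᵘ-/ i d = ℚₚ.toℚᵘ-fromℚᵘ (ℚᵘ.mkℚᵘ i d)

ℕ→ℚ-+ : ∀ m n → ℕ→ℚ (m ℕ.+ n) ≡ ℕ→ℚ m + ℕ→ℚ n
ℕ→ℚ-+ m n = ℚₚ.toℚᵘ-injective (begin
  toℚᵘ (ℕ→ℚ (m ℕ.+ n))                        ≈⟨ toℚᵘ-/ (ℤ.+ (m ℕ.+ n)) 0 ⟩
  ℚᵘ.mkℚᵘ (ℤ.+ (m ℕ.+ n)) 0                   ≈⟨ ℚᵘ.*≡* numerators ⟩
  ℚᵘ.mkℚᵘ (ℤ.+ m) 0 ℚᵘ.+ ℚᵘ.mkℚᵘ (ℤ.+ n) 0    ≈⟨ ℚᵘₚ.+-cong (toℚᵘ-/ (ℤ.+ m) 0) (toℚᵘ-/ (ℤ.+ n) 0) ⟨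
  toℚᵘ (ℕ→ℚ m) ℚᵘ.+ toℚᵘ (ℕ→ℚ n)              ≈⟨ ℚₚ.toℚᵘ-homo-+ (ℕ→ℚ m) (ℕ→ℚ n) ⟨
  toℚᵘ (ℕ→ℚ m + ℕ→ℚ n)                        ∎)
  where
  open ℚᵘₚ.≃-Reasoning
  numerators : ℤ.+ (m ℕ.+ n) ℤ.* ℤ.+ 1 ≡ (ℤ.+ m ℤ.* ℤ.+ 1 ℤ.+ ℤ.+ n ℤ.* ℤ.+ 1) ℤ.* ℤ.+ 1
  numerators = trans (ℤₚ.*-identityʳ _) (trans (ℤₚ.pos-+ m n) (sym (trans (ℤₚ.*-identityʳ _)
    (cong₂ ℤ._+_ (ℤₚ.*-identityʳ (ℤ.+ m)) (ℤₚ.*-identityʳ (ℤ.+ n))))))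

ℕ→ℚ-* : ∀ m n → ℕ→ℚ (m ℕ.* n) ≡ ℕ→ℚ m * ℕ→ℚ n
ℕ→ℚ-* m n = ℚₚ.toℚᵘ-injective (begin
  toℚᵘ (ℕ→ℚ (m ℕ.* n))                        ≈⟨ toℚᵘ-/ (ℤ.+ (m ℕ.* n)) 0 ⟩
  ℚᵘ.mkℚᵘ (ℤ.+ (m ℕ.* n)) 0                   ≈⟨ ℚᵘ.*≡* (cong (ℤ._* ℤ.+ 1) (ℤₚ.pos-* m n)) ⟩
  ℚᵘ.mkℚᵘ (ℤ.+ m) 0 ℚᵘ.* ℚᵘ.mkℚᵘ (ℤ.+ n) 0    ≈⟨ ℚᵘₚ.*-cong (toℚᵘ-/ (ℤ.+ m) 0) (toℚᵘ-/ (ℤ.+ n) 0) ⟨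
  toℚᵘ (ℕ→ℚ m) ℚᵘ.* toℚᵘ (ℕ→ℚ n)              ≈⟨ ℚₚ.toℚᵘ-homo-* (ℕ→ℚ m) (ℕ→ℚ n) ⟨
  toℚᵘ (ℕ→ℚ m * ℕ→ℚ n)                        ∎)
  where open ℚᵘₚ.≃-Reasoning

i/d*d≡i/1 : ∀ i d .{{_ : NonZero d}} → (i / d) * ℕ→ℚ d ≡ i / 1
i/d*d≡i/1 i (suc d) = ℚₚ.toℚᵘ-injective (begin
  toℚᵘ ((i / suc d) * ℕ→ℚ (suc d))                 ≈⟨ ℚₚ.toℚᵘ-homo-* (i / suc d) (ℕ→ℚ (suc d)) ⟩
  toℚᵘ (i / suc d) ℚᵘ.* toℚᵘ (ℕ→ℚ (suc d))         ≈⟨ ℚᵘₚ.*-cong (toℚᵘ-/ i d) (toℚᵘ-/ (ℤ.+ suc d) 0) ⟩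
  ℚᵘ.mkℚᵘ i d ℚᵘ.* ℚᵘ.mkℚᵘ (ℤ.+ suc d) 0
    ≈⟨ ℚᵘ.*≡* (trans (ℤₚ.*-identityʳ _) (cong (λ e → i ℤ.* ℤ.+ suc e) (sym (ℕₚ.*-identityʳ d)))) ⟩
  ℚᵘ.mkℚᵘ i 0                                      ≈⟨ toℚᵘ-/ i 0 ⟨
  toℚᵘ (i / 1)                                     ∎)
  where open ℚᵘₚ.≃-Reasoning

0≤ℕ→ℚ : ∀ n → 0ℚ ≤ ℕ→ℚ n
0≤ℕ→ℚ n = ℚₚ.nonNegative⁻¹ _ {{ℚₚ.normalize-nonNeg n 1}}

ℕ→ℚ-mono-≤ : ∀ {m n} → m ℕ.≤ n → ℕ→ℚ m ≤ ℕ→ℚ n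
ℕ→ℚ-mono-≤ {m} {n} m≤n = begin
  ℕ→ℚ m                     ≡⟨ ℚₚ.+-identityʳ (ℕ→ℚ m) ⟨
  ℕ→ℚ m + 0ℚ                ≤⟨ ℚₚ.+-monoʳ-≤ (ℕ→ℚ m) (0≤ℕ→ℚ (n ℕ.∸ m)) ⟩
  ℕ→ℚ m + ℕ→ℚ (n ℕ.∸ m)     ≡⟨ ℕ→ℚ-+ m (n ℕ.∸ m) ⟨
  ℕ→ℚ (m ℕ.+ (n ℕ.∸ m))     ≡⟨ cong ℕ→ℚ (ℕₚ.m+[n∸m]≡n m≤n) ⟩
  ℕ→ℚ n                     ∎
  where open ℚₚ.≤-Reasoning

0≤p+q : ∀ {p q} → 0ℚ ≤ p → 0ℚ ≤ q → 0ℚ ≤ p + q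
0≤p+q {p} {q} 0≤p 0≤q = ℚₚ.nonNegative⁻¹ _ {{ℚₚ.nonNeg+nonNeg⇒nonNeg p {{nonNegative 0≤p}} q {{nonNegative 0≤q}}}}

0≤p*q : ∀ {p q} → 0ℚ ≤ p → 0ℚ ≤ q → 0ℚ ≤ p * q
0≤p*q {p} {q} 0≤p 0≤q = ℚₚ.nonNegative⁻¹ _ {{ℚₚ.nonNeg*nonNeg⇒nonNeg p {{nonNegative 0≤p}} q {{nonNegative 0≤q}}}}

*-monoˡ-≤-0≤ : ∀ {r p q} → 0ℚ ≤ r → p ≤ q → r * p ≤ r * q
*-monoˡ-≤-0≤ {r} 0≤r = ℚₚ.*-monoˡ-≤-nonNeg r {{nonNegative 0≤r}}

*-monoʳ-≤-0≤ : ∀ {r p q} → 0ℚ ≤ r → p ≤ q → p * r ≤ q * r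
*-monoʳ-≤-0≤ {r} 0≤r = ℚₚ.*-monoʳ-≤-nonNeg r {{nonNegative 0≤r}}

p*p≡∣p∣*∣p∣ : ∀ p → p * p ≡ ∣ p ∣ * ∣ p ∣
p*p≡∣p∣*∣p∣ p with ℚₚ.∣p∣≡p∨∣p∣≡-p p
... | inj₁ ∣p∣≡p  rewrite ∣p∣≡p  = refl
... | inj₂ ∣p∣≡-p rewrite ∣p∣≡-p = solve (p ∷ []) ℚ-ring

0≤p*p : ∀ p → 0ℚ ≤ p * p
0≤p*p p = subst (0ℚ ≤_) (sym (p*p≡∣p∣*∣p∣ p)) (0≤p*q (ℚₚ.0≤∣p∣ p) (ℚₚ.0≤∣p∣ p))

*-self-mono-≤ : ∀ {p q} → ∣ p ∣ ≤ q → p * p ≤ q * q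
*-self-mono-≤ {p} {q} ∣p∣≤q = begin
  p * p           ≡⟨ p*p≡∣p∣*∣p∣ p ⟩
  ∣ p ∣ * ∣ p ∣   ≤⟨ *-monoˡ-≤-0≤ (ℚₚ.0≤∣p∣ p) ∣p∣≤q ⟩
  ∣ p ∣ * q       ≤⟨ *-monoʳ-≤-0≤ (ℚₚ.≤-trans (ℚₚ.0≤∣p∣ p) ∣p∣≤q) ∣p∣≤q ⟩
  q * q           ∎
  where open ℚₚ.≤-Reasoning

2pq≤p²+q² : ∀ p q → p * q + p * q ≤ p * p + q * q
2pq≤p²+q² p q = begin
  p * q + p * q                          ≡⟨ ℚₚ.+-identityˡ _ ⟨
  0ℚ + (p * q + p * q)                   ≤⟨ ℚₚ.+-monoˡ-≤ _ (0≤p*p (p - q)) ⟩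
  (p - q) * (p - q) + (p * q + p * q)    ≡⟨ solve (p ∷ q ∷ []) ℚ-ring ⟩
  p * p + q * q                          ∎
  where open ℚₚ.≤-Reasoning

sq-+-≤ : ∀ p q → (p + q) * (p + q) ≤ (p * p + q * q) + (p * p + q * q)
sq-+-≤ p q = begin
  (p + q) * (p + q)                    ≡⟨ solve (p ∷ q ∷ []) ℚ-ring ⟩
  p * p + q * q + (p * q + p * q)      ≤⟨ ℚₚ.+-monoʳ-≤ (p * p + q * q) (2pq≤p²+q² p q) ⟩
  (p * p + q * q) + (p * p + q * q)    ∎
  where open ℚₚ.≤-Reasoning

∣p+q+r∣≤∣p∣+∣q∣+∣r∣ : ∀ p q r → ∣ p + q + r ∣ ≤ ∣ p ∣ + ∣ q ∣ + ∣ r ∣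
∣p+q+r∣≤∣p∣+∣q∣+∣r∣ p q r =
  ℚₚ.≤-trans (ℚₚ.∣p+q∣≤∣p∣+∣q∣ (p + q) r) (ℚₚ.+-monoˡ-≤ ∣ r ∣ (ℚₚ.∣p+q∣≤∣p∣+∣q∣ p q))

+-mono₃-≤ : ∀ {p q r p′ q′ r′} → p ≤ p′ → q ≤ q′ → r ≤ r′ → p + q + r ≤ p′ + q′ + r′
+-mono₃-≤ p≤p′ q≤q′ r≤r′ = ℚₚ.+-mono-≤ (ℚₚ.+-mono-≤ p≤p′ q≤q′) r≤r′

+-interchange₃ : ∀ a b c a′ b′ c′ → (a + b + c) + (a′ + b′ + c′) ≡ (a + a′) + (b + b′) + (c + c′)
+-interchange₃ = solve-∀ ℚ-ring

0≤p^n : ∀ {p} → 0ℚ ≤ p → ∀ n → 0ℚ ≤ p ^ℚ n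
0≤p^n 0≤p zero    = ℚₚ.nonNegative⁻¹ 1ℚ
0≤p^n 0≤p (suc n) = 0≤p*q 0≤p (0≤p^n 0≤p n)

p^n≤1 : ∀ {p} → 0ℚ ≤ p → p ≤ 1ℚ → ∀ n → p ^ℚ n ≤ 1ℚ
p^n≤1 0≤p p≤1 zero    = ℚₚ.≤-refl
p^n≤1 {p} 0≤p p≤1 (suc n) = begin
  p * p ^ℚ n   ≤⟨ *-monoˡ-≤-0≤ 0≤p (p^n≤1 0≤p p≤1 n) ⟩
  p * 1ℚ       ≡⟨ ℚₚ.*-identityʳ p ⟩
  p            ≤⟨ p≤1 ⟩
  1ℚ           ∎
  where open ℚₚ.≤-Reasoning

^ℚ-monoˡ-≤ : ∀ {p q} → 0ℚ ≤ p → p ≤ q → ∀ n → p ^ℚ n ≤ q ^ℚ n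
^ℚ-monoˡ-≤ 0≤p p≤q zero    = ℚₚ.≤-refl
^ℚ-monoˡ-≤ {p} {q} 0≤p p≤q (suc n) = begin
  p * p ^ℚ n   ≤⟨ *-monoˡ-≤-0≤ 0≤p (^ℚ-monoˡ-≤ 0≤p p≤q n) ⟩
  p * q ^ℚ n   ≤⟨ *-monoʳ-≤-0≤ (0≤p^n (ℚₚ.≤-trans 0≤p p≤q) n) p≤q ⟩
  q * q ^ℚ n   ∎
  where open ℚₚ.≤-Reasoning

0≤½ : 0ℚ ≤ ½
0≤½ = ℚₚ.nonNegative⁻¹ ½

½≤1 : ½ ≤ 1ℚ
½≤1 = ℚₚ.≤ᵇ⇒≤ _

1^n≡1 : ∀ n → 1ℚ ^ℚ n ≡ 1ℚ
1^n≡1 zero    = refl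
1^n≡1 (suc n) = trans (ℚₚ.*-identityˡ _) (1^n≡1 n)

½^n*2^n≡1 : ∀ n → ½ ^ℚ n * ℕ→ℚ (2 ^ n) ≡ 1ℚ
½^n*2^n≡1 zero    = refl
½^n*2^n≡1 (suc n) = begin
  ½ * ½ ^ℚ n * ℕ→ℚ (2 ℕ.* 2 ^ n)          ≡⟨ cong (½ * ½ ^ℚ n *_) (ℕ→ℚ-* 2 (2 ^ n)) ⟩
  ½ * ½ ^ℚ n * (ℕ→ℚ 2 * ℕ→ℚ (2 ^ n))      ≡⟨ *-interchange ½ (½ ^ℚ n) (ℕ→ℚ 2) (ℕ→ℚ (2 ^ n)) ⟩
  (½ * ℕ→ℚ 2) * (½ ^ℚ n * ℕ→ℚ (2 ^ n))    ≡⟨ cong (1ℚ *_) (½^n*2^n≡1 n) ⟩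
  1ℚ * 1ℚ                                 ∎
  where open ≡-Reasoning

viaSE : (ℕ → ℕ → ℚ) → ℕ → ℕ → ℚ
viaSE f x zero    = 0ℚ
viaSE f x (suc y) = f (suc x) y

-- A step (-1,1) from (x, y) is a step (1,-1) from (y, x) after swapping the axes.
stepSum : (ℕ → ℕ → ℚ) → ℕ → ℕ → ℚ
stepSum f x y = f (suc x) (suc y) + viaSE f x y + viaSE (λ a b → f b a) y x

walkSum : ℕ → (ℕ → ℕ → ℚ) → ℕ → ℕ → ℚ
walkSum zero    h = h
walkSum (suc n) h = stepSum (walkSum n h)

-- walkSum n preserves every relation between the values of three weights that holds at 0 and
-- is closed under sums of three; linearity and the triangle inequality are instances.
module _ (R : ℚ → ℚ → ℚ → Set) (R-0 : R 0ℚ 0ℚ 0ℚ)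
         (R-+ : ∀ a b c a′ b′ c′ a″ b″ c″ → R a a′ a″ → R b b′ b″ → R c c′ c″ →
                R (a + b + c) (a′ + b′ + c′) (a″ + b″ + c″)) where

  stepSum-lift : ∀ {f g h} → (∀ x y → R (f x y) (g x y) (h x y)) →
                 ∀ x y → R (stepSum f x y) (stepSum g x y) (stepSum h x y)
  stepSum-lift r x y = R-+ _ _ _ _ _ _ _ _ _ (r (suc x) (suc y)) (viaSE-lift r x y) (viaSE-lift (λ a b → r b a) y x)
    where
    viaSE-lift : ∀ {f g h} → (∀ x y → R (f x y) (g x y) (h x y)) →
                 ∀ x y → R (viaSE f x y) (viaSE g x y) (viaSE h x y)
    viaSE-lift r x zero    = R-0
    viaSE-lift r x (suc y) = r (suc x) y

  walkSum-lift : ∀ {f g h} → (∀ x y → R (f x y) (g x y) (h x y)) →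
                 ∀ n x y → R (walkSum n f x y) (walkSum n g x y) (walkSum n h x y)
  walkSum-lift r zero    = r
  walkSum-lift r (suc n) = stepSum-lift (walkSum-lift r n)

walkSum-+ : ∀ n (f g : ℕ → ℕ → ℚ) x y →
            walkSum n (λ x y → f x y + g x y) x y ≡ walkSum n f x y + walkSum n g x y
walkSum-+ n f g = walkSum-lift (λ a b c → a ≡ b + c) refl sum-of-sums (λ _ _ → refl) n
  where
  sum-of-sums : ∀ a b c a′ b′ c′ a″ b″ c″ → a ≡ a′ + a″ → b ≡ b′ + b″ → c ≡ c′ + c″ →
                a + b + c ≡ (a′ + b′ + c′) + (a″ + b″ + c″)
  sum-of-sums _ _ _ a′ b′ c′ a″ b″ c″ refl refl refl = sym (+-interchange₃ a′ b′ c′ a″ b″ c″)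

walkSum-- : ∀ n (f g : ℕ → ℕ → ℚ) x y →
            walkSum n (λ x y → f x y - g x y) x y ≡ walkSum n f x y - walkSum n g x y
walkSum-- n f g = walkSum-lift (λ a b c → a ≡ b - c) refl sum-of-differences (λ _ _ → refl) n
  where
  sum-of-differences : ∀ a b c a′ b′ c′ a″ b″ c″ → a ≡ a′ - a″ → b ≡ b′ - b″ → c ≡ c′ - c″ →
                       a + b + c ≡ (a′ + b′ + c′) - (a″ + b″ + c″)
  sum-of-differences _ _ _ a′ b′ c′ a″ b″ c″ refl refl refl = solve (a′ ∷ b′ ∷ c′ ∷ a″ ∷ b″ ∷ c″ ∷ []) ℚ-ring

walkSum-abs : ∀ {f g : ℕ → ℕ → ℚ} → (∀ x y → ∣ f x y ∣ ≤ g x y) →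
              ∀ n x y → ∣ walkSum n f x y ∣ ≤ walkSum n g x y
walkSum-abs {g = g} = walkSum-lift (λ a b _ → ∣ a ∣ ≤ b) ℚₚ.≤-refl
  (λ a b c _ _ _ _ _ _ a≤ b≤ c≤ → ℚₚ.≤-trans (∣p+q+r∣≤∣p∣+∣q∣+∣r∣ a b c) (+-mono₃-≤ a≤ b≤ c≤)) {h = g}

walkSum-flip : ∀ n (h : ℕ → ℕ → ℚ) x y → walkSum n (λ a b → h b a) y x ≡ walkSum n h x y
walkSum-flip zero    h x y = refl
walkSum-flip (suc n) h x y = begin
  stepSum (walkSum n (λ a b → h b a)) y x
    ≡⟨ stepSum-lift (λ a b _ → a ≡ b) refl (λ _ _ _ _ _ _ _ _ _ p q r → cong₂ _+_ (cong₂ _+_ p q) r)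
                    {h = w} (λ a b → walkSum-flip n h b a) y x ⟩
  w (suc x) (suc y) + viaSE (λ a b → w b a) y x + viaSE w x y
    ≡⟨ +-swapʳ (w (suc x) (suc y)) _ _ ⟩
  stepSum w x y ∎
  where
  open ≡-Reasoning
  w = walkSum n h

count : (List Step → Bool) → List (List Step) → ℕ
count p ws = length (filter (λ w → p w Bool.≟ true) ws)

count-++ : ∀ p xs ys → count p (xs ++ ys) ≡ count p xs ℕ.+ count p ys
count-++ p xs ys = trans (cong length (Listₚ.filter-++ (λ w → p w Bool.≟ true) xs ys))
                         (Listₚ.length-++ (filter (λ w → p w Bool.≟ true) xs))

count-map : ∀ p f xs → count p (map f xs) ≡ count (λ w → p (f w)) xs
count-map p f []       = refl
count-map p f (x ∷ xs) with p (f x)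
... | true  = cong suc (count-map p f xs)
... | false = count-map p f xs

count-false : ∀ xs → count (λ _ → false) xs ≡ 0
count-false []       = refl
count-false (_ ∷ xs) = count-false xs

count-allWords-suc : ∀ p n → count p (allWords (suc n)) ≡ count (λ w → p (NE ∷ w)) (allWords n)
                               ℕ.+ count (λ w → p (SE ∷ w)) (allWords n) ℕ.+ count (λ w → p (NW ∷ w)) (allWords n)
count-allWords-suc p n = begin
  count p (ne ++ (se ++ (nw ++ [])))                          ≡⟨ count-++ p ne _ ⟩
  count p ne ℕ.+ count p (se ++ (nw ++ []))                   ≡⟨ cong (count p ne ℕ.+_) (count-++ p se _) ⟩
  count p ne ℕ.+ (count p se ℕ.+ count p (nw ++ []))
    ≡⟨ cong (λ l → count p ne ℕ.+ (count p se ℕ.+ count p l)) (Listₚ.++-identityʳ nw) ⟩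
  count p ne ℕ.+ (count p se ℕ.+ count p nw)                  ≡⟨ ℕₚ.+-assoc (count p ne) _ _ ⟨
  count p ne ℕ.+ count p se ℕ.+ count p nw
    ≡⟨ cong₂ ℕ._+_ (cong₂ ℕ._+_ (count-map p (NE ∷_) W) (count-map p (SE ∷_) W)) (count-map p (NW ∷_) W) ⟩
  _ ∎
  where
  open ≡-Reasoning
  W  = allWords n
  ne = map (NE ∷_) W
  se = map (SE ∷_) W
  nw = map (NW ∷_) W

count-walkSum : ∀ n x y → ℕ→ℚ (count (staysIn x y) (allWords n)) ≡ walkSum n (λ _ _ → 1ℚ) x y
count-walkSum zero    x y = refl
count-walkSum (suc n) x y = begin
  ℕ→ℚ (count (staysIn x y) (allWords (suc n)))
    ≡⟨ cong ℕ→ℚ (count-allWords-suc (staysIn x y) n) ⟩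
  ℕ→ℚ (ne ℕ.+ se ℕ.+ nw)
    ≡⟨ trans (ℕ→ℚ-+ (ne ℕ.+ se) nw) (cong (_+ ℕ→ℚ nw) (ℕ→ℚ-+ ne se)) ⟩
  ℕ→ℚ ne + ℕ→ℚ se + ℕ→ℚ nw
    ≡⟨ cong₂ _+_ (cong₂ _+_ (count-walkSum n (suc x) (suc y)) (SE-walks y)) (NW-walks x) ⟩
  stepSum (walkSum n (λ _ _ → 1ℚ)) x y ∎
  where
  open ≡-Reasoning
  W  = allWords n
  ne = count (λ w → staysIn x y (NE ∷ w)) W
  se = count (λ w → staysIn x y (SE ∷ w)) W
  nw = count (λ w → staysIn x y (NW ∷ w)) W
  SE-walks : ∀ y → ℕ→ℚ (count (λ w → staysIn x y (SE ∷ w)) W) ≡ viaSE (walkSum n (λ _ _ → 1ℚ)) x y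
  SE-walks zero    = cong ℕ→ℚ (count-false W)
  SE-walks (suc y) = count-walkSum n (suc x) y
  NW-walks : ∀ x → ℕ→ℚ (count (λ w → staysIn x y (NW ∷ w)) W) ≡ viaSE (λ a b → walkSum n (λ _ _ → 1ℚ) b a) y x
  NW-walks zero    = cong ℕ→ℚ (count-false W)
  NW-walks (suc x) = count-walkSum n x (suc y)

c≡walkSum : ∀ n → ℕ→ℚ (c n) ≡ walkSum n (λ _ _ → 1ℚ) 0 0
c≡walkSum n = count-walkSum n 0 0

-- The bound says the sum is at most √8^n 2^(-y/2): a step multiplies the weight 2^(-y/2) by
-- 2^(-1/2) twice and by 2^(1/2) once, i.e. by at most √8 in total.
walkSum-½^y-sq≤ : ∀ n x y → walkSum n (λ _ b → ½ ^ℚ b) x y * walkSum n (λ _ b → ½ ^ℚ b) x y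
                             ≤ ℕ→ℚ (8 ^ n) * ½ ^ℚ y
walkSum-½^y-sq≤ zero    x y = *-monoʳ-≤-0≤ (0≤p^n 0≤½ y) (p^n≤1 0≤½ ½≤1 y)
walkSum-½^y-sq≤ (suc n) x y = begin
  (ne + se + nw) * (ne + se + nw)              ≡⟨ cong (λ s → s * s) (+-swapʳ ne se nw) ⟩
  (ne + nw + se) * (ne + nw + se)              ≤⟨ sq-+-≤ (ne + nw) se ⟩
  ((ne + nw) * (ne + nw) + se * se) + ((ne + nw) * (ne + nw) + se * se)
                                               ≤⟨ ℚₚ.+-mono-≤ bound bound ⟩
  (Z + Z + (Z + Z) + ℕ→ℚ 4 * Z) + (Z + Z + (Z + Z) + ℕ→ℚ 4 * Z)
                                               ≡⟨ sixteen-Z (ℕ→ℚ (8 ^ n)) (½ ^ℚ y) ⟩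
  ℕ→ℚ 8 * ℕ→ℚ (8 ^ n) * ½ ^ℚ y                  ≡⟨ cong (_* ½ ^ℚ y) (ℕ→ℚ-* 8 (8 ^ n)) ⟨
  ℕ→ℚ (8 ^ suc n) * ½ ^ℚ y                      ∎
  where
  open ℚₚ.≤-Reasoning
  w = walkSum n (λ _ b → ½ ^ℚ b)
  ne = w (suc x) (suc y)
  se = viaSE w x y
  nw = viaSE (λ p q → w q p) y x
  Z = ℕ→ℚ (8 ^ n) * (½ * ½ ^ℚ y)
  0≤Z : 0ℚ ≤ Z
  0≤Z = 0≤p*q (0≤ℕ→ℚ (8 ^ n)) (0≤p^n 0≤½ (suc y))
  nw²≤ : ∀ x → viaSE (λ p q → w q p) y x * viaSE (λ p q → w q p) y x ≤ Z
  nw²≤ zero    = 0≤Z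
  nw²≤ (suc x) = walkSum-½^y-sq≤ n x (suc y)
  se²≤ : ∀ y → viaSE w x y * viaSE w x y ≤ ℕ→ℚ 4 * (ℕ→ℚ (8 ^ n) * (½ * ½ ^ℚ y))
  se²≤ zero    = 0≤p*q (0≤ℕ→ℚ 4) (0≤p*q (0≤ℕ→ℚ (8 ^ n)) (0≤p^n 0≤½ 1))
  se²≤ (suc y) = ℚₚ.≤-trans (walkSum-½^y-sq≤ n (suc x) y) (ℚₚ.≤-reflexive (quarter (ℕ→ℚ (8 ^ n)) (½ ^ℚ y)))
    where
    quarter : ∀ E P → E * P ≡ ℕ→ℚ 4 * (E * (½ * (½ * P)))
    quarter = solve-∀ ℚ-ring
  bound : (ne + nw) * (ne + nw) + se * se ≤ Z + Z + (Z + Z) + ℕ→ℚ 4 * Z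
  bound = ℚₚ.+-mono-≤ (ℚₚ.≤-trans (sq-+-≤ ne nw)
            (ℚₚ.+-mono-≤ (ℚₚ.+-mono-≤ (walkSum-½^y-sq≤ n (suc x) (suc y)) (nw²≤ x))
                         (ℚₚ.+-mono-≤ (walkSum-½^y-sq≤ n (suc x) (suc y)) (nw²≤ x)))) (se²≤ y)
  sixteen-Z : ∀ E P → let Z = E * (½ * P) in
    (Z + Z + (Z + Z) + ℕ→ℚ 4 * Z) + (Z + Z + (Z + Z) + ℕ→ℚ 4 * Z) ≡ ℕ→ℚ 8 * E * P
  sixteen-Z = solve-∀ ℚ-ring

-- G i j is the value at the lattice point (i - 1, j - 1): the quadrant together with the
-- lines x = -1 and y = -1 just outside it, which a single step can reach.
Harmonic : (ℕ → ℕ → ℚ) → Set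
Harmonic G = ∀ i j →
  ℕ→ℚ 3 * G (suc i) (suc j) ≡ G (suc (suc i)) (suc (suc j)) + G (suc (suc i)) j + G i (suc (suc j))

harmonic-error-split : ∀ k t g g₁ g₂ g₃ s₁ s₂ s₃ → k * g ≡ g₁ + g₂ + g₃ →
  k * t * g - (s₁ + s₂ + s₃) ≡ (t * g₁ - s₁) + (t * g₂ - s₂) + (t * g₃ - s₃)
harmonic-error-split k t g g₁ g₂ g₃ s₁ s₂ s₃ kg≡ = begin
  k * t * g - (s₁ + s₂ + s₃)                          ≡⟨ solve (k ∷ t ∷ g ∷ s₁ ∷ s₂ ∷ s₃ ∷ []) ℚ-ring ⟩
  t * (k * g) - (s₁ + s₂ + s₃)                        ≡⟨ cong (λ h → t * h - (s₁ + s₂ + s₃)) kg≡ ⟩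
  t * (g₁ + g₂ + g₃) - (s₁ + s₂ + s₃)                 ≡⟨ solve (t ∷ g₁ ∷ g₂ ∷ g₃ ∷ s₁ ∷ s₂ ∷ s₃ ∷ []) ℚ-ring ⟩
  (t * g₁ - s₁) + (t * g₂ - s₂) + (t * g₃ - s₃)       ∎
  where open ≡-Reasoning

-- By harmonicity 3^n G sums G over the endpoints of all 3^n unrestricted walks; walkSum
-- drops each walk at its first exit from the quadrant, where |G| ≤ δ.
walkSum-harmonic : ∀ {G δ} → Harmonic G → (∀ i → ∣ G (suc i) 0 ∣ ≤ δ) → (∀ j → ∣ G 0 (suc j) ∣ ≤ δ) →
  ∀ n x y → ∣ ℕ→ℚ (3 ^ n) * G (suc x) (suc y) - walkSum n (λ a b → G (suc a) (suc b)) x y ∣ ≤ ℕ→ℚ (3 ^ n) * δ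
walkSum-harmonic {G} {δ} harmonic bdyˣ bdyʸ zero x y = begin
  ∣ 1ℚ * g - g ∣    ≡⟨ cong (λ h → ∣ h - g ∣) (ℚₚ.*-identityˡ g) ⟩
  ∣ g - g ∣         ≡⟨ cong ∣_∣ (ℚₚ.+-inverseʳ g) ⟩
  0ℚ                ≤⟨ ℚₚ.≤-trans (ℚₚ.0≤∣p∣ _) (bdyˣ 0) ⟩
  δ                 ≡⟨ ℚₚ.*-identityˡ δ ⟨
  1ℚ * δ            ∎
  where
  open ℚₚ.≤-Reasoning
  g = G (suc x) (suc y)
walkSum-harmonic {G} {δ} harmonic bdyˣ bdyʸ (suc n) x y = begin
  ∣ ℕ→ℚ (3 ^ suc n) * G (suc x) (suc y) - stepSum w x y ∣
    ≡⟨ cong (λ k → ∣ k * G (suc x) (suc y) - stepSum w x y ∣) (ℕ→ℚ-* 3 (3 ^ n)) ⟩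
  ∣ ℕ→ℚ 3 * t * G (suc x) (suc y) - stepSum w x y ∣
    ≡⟨ cong ∣_∣ (harmonic-error-split (ℕ→ℚ 3) t _ _ _ _ _ _ _ (harmonic x y)) ⟩
  ∣ e-NE + e-SE + e-NW ∣                          ≤⟨ ∣p+q+r∣≤∣p∣+∣q∣+∣r∣ e-NE e-SE e-NW ⟩
  ∣ e-NE ∣ + ∣ e-SE ∣ + ∣ e-NW ∣                  ≤⟨ +-mono₃-≤ (walkSum-harmonic {G} harmonic bdyˣ bdyʸ n (suc x) (suc y))
                                                                (SE-error y) (NW-error x) ⟩
  t * δ + t * δ + t * δ                           ≡⟨ thrice t δ ⟩
  ℕ→ℚ 3 * t * δ                                   ≡⟨ cong (_* δ) (ℕ→ℚ-* 3 (3 ^ n)) ⟨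
  ℕ→ℚ (3 ^ suc n) * δ                             ∎
  where
  open ℚₚ.≤-Reasoning
  t = ℕ→ℚ (3 ^ n)
  w = walkSum n (λ a b → G (suc a) (suc b))
  e-NE = t * G (suc (suc x)) (suc (suc y)) - w (suc x) (suc y)
  e-SE = t * G (suc (suc x)) y - viaSE w x y
  e-NW = t * G x (suc (suc y)) - viaSE (λ a b → w b a) y x
  thrice : ∀ t δ → t * δ + t * δ + t * δ ≡ ℕ→ℚ 3 * t * δ
  thrice = solve-∀ ℚ-ring
  killed : ∀ {g} → ∣ g ∣ ≤ δ → ∣ t * g - 0ℚ ∣ ≤ t * δ
  killed {g} ∣g∣≤δ = begin
    ∣ t * g - 0ℚ ∣    ≡⟨ cong ∣_∣ (ℚₚ.+-identityʳ (t * g)) ⟩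
    ∣ t * g ∣         ≡⟨ ℚₚ.∣p*q∣≡∣p∣*∣q∣ t g ⟩
    ∣ t ∣ * ∣ g ∣     ≡⟨ cong (_* ∣ g ∣) (ℚₚ.0≤p⇒∣p∣≡p (0≤ℕ→ℚ (3 ^ n))) ⟩
    t * ∣ g ∣         ≤⟨ *-monoˡ-≤-0≤ (0≤ℕ→ℚ (3 ^ n)) ∣g∣≤δ ⟩
    t * δ             ∎
  SE-error : ∀ y → ∣ t * G (suc (suc x)) y - viaSE w x y ∣ ≤ t * δ
  SE-error zero    = killed (bdyˣ (suc x))
  SE-error (suc y) = walkSum-harmonic {G} harmonic bdyˣ bdyʸ n (suc x) y
  NW-error : ∀ x → ∣ t * G x (suc (suc y)) - viaSE (λ a b → w b a) y x ∣ ≤ t * δ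
  NW-error zero    = killed (bdyʸ (suc y))
  NW-error (suc x) = walkSum-harmonic {G} harmonic bdyˣ bdyʸ n x (suc y)

harmonic-+ : ∀ {G G′} → Harmonic G → Harmonic G′ → Harmonic (λ i j → G i j + G′ i j)
harmonic-+ {G} {G′} harmonic harmonic′ i j = begin
  ℕ→ℚ 3 * (G (suc i) (suc j) + G′ (suc i) (suc j))           ≡⟨ ℚₚ.*-distribˡ-+ (ℕ→ℚ 3) (G (suc i) (suc j)) _ ⟩
  ℕ→ℚ 3 * G (suc i) (suc j) + ℕ→ℚ 3 * G′ (suc i) (suc j)     ≡⟨ cong₂ _+_ (harmonic i j) (harmonic′ i j) ⟩
  (ne + se + nw) + (ne′ + se′ + nw′)                          ≡⟨ +-interchange₃ ne se nw ne′ se′ nw′ ⟩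
  (ne + ne′) + (se + se′) + (nw + nw′)                        ∎
  where
  open ≡-Reasoning
  ne = G (suc (suc i)) (suc (suc j))
  se = G (suc (suc i)) j
  nw = G i (suc (suc j))
  ne′ = G′ (suc (suc i)) (suc (suc j))
  se′ = G′ (suc (suc i)) j
  nw′ = G′ i (suc (suc j))

harmonic-−* : ∀ {G G′} s → Harmonic G → Harmonic G′ → Harmonic (λ i j → G i j - s * G′ i j)
harmonic-−* {G} {G′} s harmonic harmonic′ i j = begin
  ℕ→ℚ 3 * (G (suc i) (suc j) - s * G′ (suc i) (suc j))
    ≡⟨ distrib (ℕ→ℚ 3) s (G (suc i) (suc j)) (G′ (suc i) (suc j)) ⟩
  ℕ→ℚ 3 * G (suc i) (suc j) - s * (ℕ→ℚ 3 * G′ (suc i) (suc j))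
    ≡⟨ cong₂ (λ a b → a - s * b) (harmonic i j) (harmonic′ i j) ⟩
  (ne + se + nw) - s * (ne′ + se′ + nw′)
    ≡⟨ regroup s ne se nw ne′ se′ nw′ ⟩
  (ne - s * ne′) + (se - s * se′) + (nw - s * nw′)
    ∎
  where
  open ≡-Reasoning
  ne = G (suc (suc i)) (suc (suc j))
  se = G (suc (suc i)) j
  nw = G i (suc (suc j))
  ne′ = G′ (suc (suc i)) (suc (suc j))
  se′ = G′ (suc (suc i)) j
  nw′ = G′ i (suc (suc j))
  distrib : ∀ k s a b → k * (a - s * b) ≡ k * a - s * (k * b)
  distrib = solve-∀ ℚ-ring
  regroup : ∀ s a b c a′ b′ c′ → (a + b + c) - s * (a′ + b′ + c′) ≡ (a - s * a′) + (b - s * b′) + (c - s * c′)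
  regroup = solve-∀ ℚ-ring

harmonic-flip : ∀ {G} → Harmonic G → Harmonic (λ i j → G j i)
harmonic-flip {G} harmonic i j = trans (harmonic j i) (+-swapʳ (G (suc (suc j)) (suc (suc i))) _ _)

harmonic-monomial : ∀ p q → ℕ→ℚ 3 * (p * q) ≡ p * p * (q * q) + p * p + q * q →
                    Harmonic (λ i j → p ^ℚ i * q ^ℚ j)
harmonic-monomial p q markov i j = begin
  ℕ→ℚ 3 * (p * p ^ℚ i * (q * q ^ℚ j))                    ≡⟨ factor (ℕ→ℚ 3) p q (p ^ℚ i) (q ^ℚ j) ⟩
  ℕ→ℚ 3 * (p * q) * (p ^ℚ i * q ^ℚ j)                    ≡⟨ cong (_* (p ^ℚ i * q ^ℚ j)) markov ⟩
  (p * p * (q * q) + p * p + q * q) * (p ^ℚ i * q ^ℚ j)  ≡⟨ expand p q (p ^ℚ i) (q ^ℚ j) ⟩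
  p * (p * p ^ℚ i) * (q * (q * q ^ℚ j)) + p * (p * p ^ℚ i) * q ^ℚ j + p ^ℚ i * (q * (q * q ^ℚ j)) ∎
  where
  open ≡-Reasoning
  factor : ∀ k p q pⁱ qʲ → k * (p * pⁱ * (q * qʲ)) ≡ k * (p * q) * (pⁱ * qʲ)
  factor = solve-∀ ℚ-ring
  expand : ∀ p q pⁱ qʲ → (p * p * (q * q) + p * p + q * q) * (pⁱ * qʲ)
                        ≡ p * (p * pⁱ) * (q * (q * qʲ)) + p * (p * pⁱ) * qʲ + pⁱ * (q * (q * qʲ))
  expand = solve-∀ ℚ-ring

oddFib : ℕ → ℕ
oddFib k = F (suc (2 ℕ.* k))

oddFib-suc : ∀ k → oddFib (suc k) ≡ F (suc (suc (suc (2 ℕ.* k))))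
oddFib-suc k = cong (λ m → F (suc m)) (ℕₚ.*-suc 2 k)

F-skip₂ : ∀ m → F (suc (suc (suc (suc m)))) ℕ.+ F m ≡ 3 ℕ.* F (suc (suc m))
F-skip₂ m = identity (F (suc m)) (F m)
  where
  identity : ∀ a b → (a ℕ.+ b ℕ.+ a) ℕ.+ (a ℕ.+ b) ℕ.+ b ≡ 3 ℕ.* (a ℕ.+ b)
  identity = ℕ-Solver.solve-∀

oddFib-rec : ∀ k → oddFib (suc (suc k)) ℕ.+ oddFib k ≡ 3 ℕ.* oddFib (suc k)
oddFib-rec k = begin
  oddFib (suc (suc k)) ℕ.+ oddFib k
    ≡⟨ cong (ℕ._+ oddFib k) (trans (oddFib-suc (suc k)) (cong (λ m → F (suc (suc (suc m)))) (ℕₚ.*-suc 2 k))) ⟩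
  F (suc (suc (suc (suc (suc (2 ℕ.* k)))))) ℕ.+ F (suc (2 ℕ.* k))
    ≡⟨ F-skip₂ (suc (2 ℕ.* k)) ⟩
  3 ℕ.* F (suc (suc (suc (2 ℕ.* k))))
    ≡⟨ cong (3 ℕ.*_) (oddFib-suc k) ⟨
  3 ℕ.* oddFib (suc k) ∎
  where open ≡-Reasoning

-- Vieta jumping: c = t b - a is the other root of X² - t b X + (b² + 1).
vieta-step : ∀ t a b c → a * a + b * b + 1ℚ ≡ t * (a * b) → c + a ≡ t * b → b * b + c * c + 1ℚ ≡ t * (b * c)
vieta-step t a b c markov sum = begin
  b * b + c * c + 1ℚ
    ≡⟨ solve (t ∷ a ∷ b ∷ c ∷ []) ℚ-ring ⟩
  (a * a + b * b + 1ℚ) - t * (a * b) + ((c + a) - t * b) * (c - a) + t * (b * c)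
    ≡⟨ cong₂ (λ m s → m - t * (a * b) + (s - t * b) * (c - a) + t * (b * c)) markov sum ⟩
  t * (a * b) - t * (a * b) + (t * b - t * b) * (c - a) + t * (b * c)
    ≡⟨ solve (t ∷ a ∷ b ∷ c ∷ []) ℚ-ring ⟩
  t * (b * c) ∎
  where open ≡-Reasoning

oddFib-markov : ∀ k → let a = ℕ→ℚ (oddFib k) ; b = ℕ→ℚ (oddFib (suc k)) in
                a * a + b * b + 1ℚ ≡ ℕ→ℚ 3 * (a * b)
oddFib-markov zero    = refl
oddFib-markov (suc k) = vieta-step (ℕ→ℚ 3) (ℕ→ℚ (oddFib k)) (ℕ→ℚ (oddFib (suc k))) (ℕ→ℚ (oddFib (suc (suc k))))
  (oddFib-markov k) (begin
  ℕ→ℚ (oddFib (suc (suc k))) + ℕ→ℚ (oddFib k)   ≡⟨ ℕ→ℚ-+ (oddFib (suc (suc k))) (oddFib k) ⟨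
  ℕ→ℚ (oddFib (suc (suc k)) ℕ.+ oddFib k)        ≡⟨ cong ℕ→ℚ (oddFib-rec k) ⟩
  ℕ→ℚ (3 ℕ.* oddFib (suc k))                     ≡⟨ ℕ→ℚ-* 3 (oddFib (suc k)) ⟩
  ℕ→ℚ 3 * ℕ→ℚ (oddFib (suc k))                   ∎)
  where open ≡-Reasoning

markov-reciprocal : ∀ t a b p q → p * a ≡ 1ℚ → q * b ≡ 1ℚ → a * a + b * b + 1ℚ ≡ t * (a * b) →
                    t * (p * q) ≡ p * p * (q * q) + p * p + q * q
markov-reciprocal t a b p q pa≡1 qb≡1 markov = begin
  t * (p * q)                                                ≡⟨ solve (t ∷ p ∷ q ∷ []) ℚ-ring ⟩
  t * (p * q) * 1ℚ * 1ℚ                                      ≡⟨ cong₂ (λ u v → t * (p * q) * u * v) pa≡1 qb≡1 ⟨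
  t * (p * q) * (p * a) * (q * b)                            ≡⟨ solve (t ∷ a ∷ b ∷ p ∷ q ∷ []) ℚ-ring ⟩
  p * p * (q * q) * (t * (a * b))                            ≡⟨ cong (p * p * (q * q) *_) markov ⟨
  p * p * (q * q) * (a * a + b * b + 1ℚ)                     ≡⟨ solve (a ∷ b ∷ p ∷ q ∷ []) ℚ-ring ⟩
  (p * a) * (p * a) * (q * q) + (q * b) * (q * b) * (p * p) + p * p * (q * q)
                                                             ≡⟨ cong₂ (λ u v → u * u * (q * q) + v * v * (p * p) + p * p * (q * q)) pa≡1 qb≡1 ⟩
  1ℚ * 1ℚ * (q * q) + 1ℚ * 1ℚ * (p * p) + p * p * (q * q)    ≡⟨ solve (p ∷ q ∷ []) ℚ-ring ⟩
  p * p * (q * q) + p * p + q * q                            ∎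
  where open ≡-Reasoning

P : ℕ → ℚ
P k = (ℤ.+ 1 / oddFib k) {{F-suc-nonZero (2 ℕ.* k)}}

P*oddFib≡1 : ∀ k → P k * ℕ→ℚ (oddFib k) ≡ 1ℚ
P*oddFib≡1 k = i/d*d≡i/1 (ℤ.+ 1) (oddFib k) {{F-suc-nonZero (2 ℕ.* k)}}

P-markov : ∀ k → ℕ→ℚ 3 * (P k * P (suc k)) ≡ P k * P k * (P (suc k) * P (suc k)) + P k * P k + P (suc k) * P (suc k)
P-markov k = markov-reciprocal (ℕ→ℚ 3) (ℕ→ℚ (oddFib k)) (ℕ→ℚ (oddFib (suc k))) (P k) (P (suc k))
                               (P*oddFib≡1 k) (P*oddFib≡1 (suc k)) (oddFib-markov k)

T : ℕ → ℕ → ℕ → ℚ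
T k i j = P k ^ℚ i * P (suc k) ^ℚ j + P k ^ℚ j * P (suc k) ^ℚ i

harmonic-T : ∀ k → Harmonic (T k)
harmonic-T k = harmonic-+ {M} {λ i j → M j i} monomial (harmonic-flip {M} monomial)
  where
  M = λ i j → P k ^ℚ i * P (suc k) ^ℚ j
  monomial = harmonic-monomial (P k) (P (suc k)) (P-markov k)

signℚ : ℕ → ℚ
signℚ k = sign k / 1

sign≡±1 : ∀ k → sign k ≡ ℤ.+ 1 ⊎ sign k ≡ ℤ.-[1+ 0 ]
sign≡±1 zero    = inj₁ refl
sign≡±1 (suc k) with sign≡±1 k
... | inj₁ eq = inj₂ (cong ℤ.-_ eq)
... | inj₂ eq = inj₁ (cong ℤ.-_ eq)

signℚ-suc : ∀ k → signℚ (suc k) ≡ - signℚ k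
signℚ-suc k with sign≡±1 k
... | inj₁ eq rewrite eq = refl
... | inj₂ eq rewrite eq = refl

∣signℚ∣≡1 : ∀ k → ∣ signℚ k ∣ ≡ 1ℚ
∣signℚ∣≡1 zero    = refl
∣signℚ∣≡1 (suc k) = trans (cong ∣_∣ (signℚ-suc k)) (trans (ℚₚ.∣-p∣≡∣p∣ (signℚ k)) (∣signℚ∣≡1 k))

H : ℕ → ℕ → ℕ → ℚ
H zero    i j = 1ℚ
H (suc N) i j = H N i j - signℚ N * T N i j

harmonic-H : ∀ N → Harmonic (H N)
harmonic-H zero    i j = refl
harmonic-H (suc N)     = harmonic-−* {H N} {T N} (signℚ N) (harmonic-H N) (harmonic-T N)

H-sym : ∀ N i j → H N i j ≡ H N j i
H-sym zero    i j = refl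
H-sym (suc N) i j = cong₂ (λ h t → h - signℚ N * t) (H-sym N i j) (ℚₚ.+-comm (P N ^ℚ i * P (suc N) ^ℚ j) _)

H-boundary : ∀ N i → H N i 0 ≡ signℚ N * P N ^ℚ i
H-boundary zero    i = sym (trans (ℚₚ.*-identityˡ _) (1^n≡1 i))
H-boundary (suc N) i = begin
  H N i 0 - signℚ N * T N i 0                  ≡⟨ cong (_- signℚ N * T N i 0) (H-boundary N i) ⟩
  signℚ N * p - signℚ N * (p * 1ℚ + 1ℚ * q)    ≡⟨ telescope (signℚ N) p q ⟩
  - signℚ N * q                                ≡⟨ cong (_* q) (signℚ-suc N) ⟨
  signℚ (suc N) * q                            ∎
  where
  open ≡-Reasoning
  p = P N ^ℚ i
  q = P (suc N) ^ℚ i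
  telescope : ∀ s p q → s * p - s * (p * 1ℚ + 1ℚ * q) ≡ - s * q
  telescope = solve-∀ ℚ-ring

term≡ : ∀ k → term k ≡ signℚ k * (P k * P (suc k))
term≡ k = begin
  term k                                    ≡⟨ ℚₚ.*-identityʳ (term k) ⟨
  term k * 1ℚ                               ≡⟨ cong (term k *_) d*PP≡1 ⟨
  term k * (ℕ→ℚ d * (P k * P (suc k)))      ≡⟨ ℚₚ.*-assoc (term k) (ℕ→ℚ d) _ ⟨
  term k * ℕ→ℚ d * (P k * P (suc k))        ≡⟨ cong (_* (P k * P (suc k))) (i/d*d≡i/1 (sign k) d {{d≢0}}) ⟩
  signℚ k * (P k * P (suc k))               ∎
  where
  open ≡-Reasoning
  d = F (suc (2 ℕ.* k)) ℕ.* F (suc (suc (suc (2 ℕ.* k))))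
  d≢0 : NonZero d
  d≢0 = ℕₚ.m*n≢0 _ _ {{F-suc-nonZero (2 ℕ.* k)}} {{F-suc-nonZero (suc (suc (2 ℕ.* k)))}}
  d*PP≡1 : ℕ→ℚ d * (P k * P (suc k)) ≡ 1ℚ
  d*PP≡1 = begin
    ℕ→ℚ d * (P k * P (suc k))
      ≡⟨ cong (λ m → ℕ→ℚ (oddFib k ℕ.* m) * (P k * P (suc k))) (oddFib-suc k) ⟨
    ℕ→ℚ (oddFib k ℕ.* oddFib (suc k)) * (P k * P (suc k))
      ≡⟨ cong (_* (P k * P (suc k))) (ℕ→ℚ-* (oddFib k) (oddFib (suc k))) ⟩
    ℕ→ℚ (oddFib k) * ℕ→ℚ (oddFib (suc k)) * (P k * P (suc k))
      ≡⟨ ℚₚ.*-comm (ℕ→ℚ (oddFib k) * ℕ→ℚ (oddFib (suc k))) _ ⟩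
    P k * P (suc k) * (ℕ→ℚ (oddFib k) * ℕ→ℚ (oddFib (suc k)))
      ≡⟨ *-interchange (P k) (P (suc k)) _ _ ⟩
    P k * ℕ→ℚ (oddFib k) * (P (suc k) * ℕ→ℚ (oddFib (suc k)))
      ≡⟨ cong₂ _*_ (P*oddFib≡1 k) (P*oddFib≡1 (suc k)) ⟩
    1ℚ * 1ℚ ∎

αPartial≡H : ∀ N → αPartial N ≡ H N 1 1
αPartial≡H zero    = refl
αPartial≡H (suc N) = begin
  1ℚ - (ℤ.+ 2 / 1) * (partialSum N + term N)
    ≡⟨ cong (λ t → 1ℚ - (ℤ.+ 2 / 1) * (partialSum N + t)) (term≡ N) ⟩
  1ℚ - (ℤ.+ 2 / 1) * (partialSum N + signℚ N * (P N * P (suc N)))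
    ≡⟨ regroup (partialSum N) (signℚ N) (P N) (P (suc N)) ⟩
  αPartial N - signℚ N * T N 1 1
    ≡⟨ cong (_- signℚ N * T N 1 1) (αPartial≡H N) ⟩
  H N 1 1 - signℚ N * T N 1 1 ∎
  where
  open ≡-Reasoning
  regroup : ∀ S s p q → 1ℚ - (ℤ.+ 2 / 1) * (S + s * (p * q))
                        ≡ (1ℚ - (ℤ.+ 2 / 1) * S) - s * (p * 1ℚ * (q * 1ℚ) + p * 1ℚ * (q * 1ℚ))
  regroup = solve-∀ ℚ-ring

0≤P : ∀ k → 0ℚ ≤ P k
0≤P k = ℚₚ.nonNegative⁻¹ (P k) {{ℚₚ.normalize-nonNeg 1 (oddFib k) {{F-suc-nonZero (2 ℕ.* k)}}}}

2^k≤oddFib : ∀ k → 2 ^ k ℕ.≤ oddFib k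
2^k≤oddFib zero    = ℕₚ.≤-refl
2^k≤oddFib (suc k) = begin
  2 ℕ.* 2 ^ k                              ≤⟨ ℕₚ.*-monoʳ-≤ 2 (2^k≤oddFib k) ⟩
  oddFib k ℕ.+ (oddFib k ℕ.+ 0)            ≡⟨ ℕₚ.+-comm (oddFib k) _ ⟩
  oddFib k ℕ.+ 0 ℕ.+ oddFib k              ≤⟨ ℕₚ.+-monoˡ-≤ (oddFib k) (ℕₚ.+-monoʳ-≤ (oddFib k) ℕ.z≤n) ⟩
  oddFib k ℕ.+ F (2 ℕ.* k) ℕ.+ oddFib k    ≡⟨ oddFib-suc k ⟨
  oddFib (suc k)                           ∎
  where open ℕₚ.≤-Reasoning

n<2^n : ∀ n → n ℕ.< 2 ^ n
n<2^n zero    = ℕ.s≤s ℕ.z≤n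
n<2^n (suc n) = ℕₚ.+-mono-≤-< (ℕₚ.m^n>0 2 n) (ℕₚ.<-≤-trans (n<2^n n) (ℕₚ.m≤m+n (2 ^ n) 0))

inverse-antitone : ∀ {x y a b} → 0ℚ ≤ x → 0ℚ ≤ y → x * a ≡ 1ℚ → y * b ≡ 1ℚ → a ≤ b → y ≤ x
inverse-antitone {x} {y} {a} {b} 0≤x 0≤y xa≡1 yb≡1 a≤b = begin
  y              ≡⟨ ℚₚ.*-identityʳ y ⟨
  y * 1ℚ         ≡⟨ cong (y *_) xa≡1 ⟨
  y * (x * a)    ≡⟨ solve (x ∷ y ∷ a ∷ []) ℚ-ring ⟩
  y * a * x      ≤⟨ *-monoʳ-≤-0≤ 0≤x (*-monoˡ-≤-0≤ 0≤y a≤b) ⟩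
  y * b * x      ≡⟨ cong (_* x) yb≡1 ⟩
  1ℚ * x         ≡⟨ ℚₚ.*-identityˡ x ⟩
  x              ∎
  where open ℚₚ.≤-Reasoning

P≤½^k : ∀ k → P k ≤ ½ ^ℚ k
P≤½^k k = inverse-antitone (0≤p^n 0≤½ k) (0≤P k) (½^n*2^n≡1 k) (P*oddFib≡1 k) (ℕ→ℚ-mono-≤ (2^k≤oddFib k))

P≤1 : ∀ k → P k ≤ 1ℚ
P≤1 k = ℚₚ.≤-trans (P≤½^k k) (p^n≤1 0≤½ ½≤1 k)

ℕ→ℚ-*P≤1 : ∀ {K N} → K ℕ.≤ N → ℕ→ℚ K * P N ≤ 1ℚ
ℕ→ℚ-*P≤1 {K} {N} K≤N = begin
  ℕ→ℚ K * P N              ≤⟨ *-monoʳ-≤-0≤ (0≤P N) (ℕ→ℚ-mono-≤ K≤oddFib) ⟩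
  ℕ→ℚ (oddFib N) * P N     ≡⟨ ℚₚ.*-comm (ℕ→ℚ (oddFib N)) (P N) ⟩
  P N * ℕ→ℚ (oddFib N)     ≡⟨ P*oddFib≡1 N ⟩
  1ℚ                       ∎
  where
  open ℚₚ.≤-Reasoning
  K≤oddFib = ℕₚ.≤-trans K≤N (ℕₚ.≤-trans (ℕₚ.<⇒≤ (n<2^n N)) (2^k≤oddFib N))

∣H-boundary∣≤P : ∀ N i → ∣ H N (suc i) 0 ∣ ≤ P N
∣H-boundary∣≤P N i = begin
  ∣ H N (suc i) 0 ∣                   ≡⟨ cong ∣_∣ (H-boundary N (suc i)) ⟩
  ∣ signℚ N * P N ^ℚ suc i ∣          ≡⟨ ℚₚ.∣p*q∣≡∣p∣*∣q∣ (signℚ N) (P N ^ℚ suc i) ⟩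
  ∣ signℚ N ∣ * ∣ P N ^ℚ suc i ∣      ≡⟨ cong₂ _*_ (∣signℚ∣≡1 N) (ℚₚ.0≤p⇒∣p∣≡p (0≤p^n (0≤P N) (suc i))) ⟩
  1ℚ * (P N * P N ^ℚ i)               ≡⟨ ℚₚ.*-identityˡ _ ⟩
  P N * P N ^ℚ i                      ≤⟨ *-monoˡ-≤-0≤ (0≤P N) (p^n≤1 (0≤P N) (P≤1 N) i) ⟩
  P N * 1ℚ                            ≡⟨ ℚₚ.*-identityʳ (P N) ⟩
  P N                                 ∎
  where open ℚₚ.≤-Reasoning

0≤T : ∀ k i j → 0ℚ ≤ T k i j
0≤T k i j = 0≤p+q (0≤p*q (0≤p^n (0≤P k) i) (0≤p^n (0≤P (suc k)) j))
                  (0≤p*q (0≤p^n (0≤P k) j) (0≤p^n (0≤P (suc k)) i))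

T-interior≤ : ∀ k x y → T k (suc x) (suc y) ≤ ½ ^ℚ suc k * (½ ^ℚ x + ½ ^ℚ y)
T-interior≤ k x y = begin
  p ^ℚ suc x * q ^ℚ suc y + p ^ℚ suc y * q ^ℚ suc x   ≤⟨ ℚₚ.+-mono-≤ (monomial≤ x y) (monomial≤ y x) ⟩
  ½ ^ℚ suc k * ½ ^ℚ y + ½ ^ℚ suc k * ½ ^ℚ x           ≡⟨ ℚₚ.+-comm (½ ^ℚ suc k * ½ ^ℚ y) _ ⟩
  ½ ^ℚ suc k * ½ ^ℚ x + ½ ^ℚ suc k * ½ ^ℚ y           ≡⟨ ℚₚ.*-distribˡ-+ (½ ^ℚ suc k) _ _ ⟨
  ½ ^ℚ suc k * (½ ^ℚ x + ½ ^ℚ y)                     ∎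
  where
  open ℚₚ.≤-Reasoning
  p = P k
  q = P (suc k)
  q≤½ : q ≤ ½
  q≤½ = ℚₚ.≤-trans (P≤½^k (suc k))
          (ℚₚ.≤-trans (*-monoˡ-≤-0≤ 0≤½ (p^n≤1 0≤½ ½≤1 k)) (ℚₚ.≤-reflexive (ℚₚ.*-identityʳ ½)))
  monomial≤ : ∀ i j → p ^ℚ suc i * q ^ℚ suc j ≤ ½ ^ℚ suc k * ½ ^ℚ j
  monomial≤ i j = begin
    p ^ℚ suc i * q ^ℚ suc j     ≤⟨ *-monoʳ-≤-0≤ (0≤p^n (0≤P (suc k)) (suc j)) (p^n≤1 (0≤P k) (P≤1 k) (suc i)) ⟩
    1ℚ * (q * q ^ℚ j)           ≡⟨ ℚₚ.*-identityˡ _ ⟩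
    q * q ^ℚ j                  ≤⟨ *-monoʳ-≤-0≤ (0≤p^n (0≤P (suc k)) j) (P≤½^k (suc k)) ⟩
    ½ ^ℚ suc k * q ^ℚ j         ≤⟨ *-monoˡ-≤-0≤ (0≤p^n 0≤½ (suc k)) (^ℚ-monoˡ-≤ (0≤P (suc k)) q≤½ j) ⟩
    ½ ^ℚ suc k * ½ ^ℚ j         ∎

1-H-interior≤ : ∀ N x y → ∣ 1ℚ - H N (suc x) (suc y) ∣ ≤ (1ℚ - ½ ^ℚ N) * (½ ^ℚ x + ½ ^ℚ y)
1-H-interior≤ zero    x y = ℚₚ.≤-reflexive (sym (ℚₚ.*-zeroˡ (½ ^ℚ x + ½ ^ℚ y)))
1-H-interior≤ (suc N) x y = begin
  ∣ 1ℚ - (h - signℚ N * t) ∣             ≡⟨ cong ∣_∣ (rearrange h (signℚ N) t) ⟩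
  ∣ (1ℚ - h) + signℚ N * t ∣             ≤⟨ ℚₚ.∣p+q∣≤∣p∣+∣q∣ (1ℚ - h) (signℚ N * t) ⟩
  ∣ 1ℚ - h ∣ + ∣ signℚ N * t ∣           ≡⟨ cong (∣ 1ℚ - h ∣ +_) ∣signℚ*t∣≡t ⟩
  ∣ 1ℚ - h ∣ + t                         ≤⟨ ℚₚ.+-mono-≤ (1-H-interior≤ N x y) (T-interior≤ N x y) ⟩
  (1ℚ - ½ ^ℚ N) * S + ½ * ½ ^ℚ N * S     ≡⟨ halve (½ ^ℚ N) S ⟩
  (1ℚ - ½ * ½ ^ℚ N) * S                  ∎
  where
  open ℚₚ.≤-Reasoning
  h = H N (suc x) (suc y)
  t = T N (suc x) (suc y)
  S = ½ ^ℚ x + ½ ^ℚ y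
  ∣signℚ*t∣≡t : ∣ signℚ N * t ∣ ≡ t
  ∣signℚ*t∣≡t = trans (ℚₚ.∣p*q∣≡∣p∣*∣q∣ (signℚ N) t)
                 (trans (cong₂ _*_ (∣signℚ∣≡1 N) (ℚₚ.0≤p⇒∣p∣≡p (0≤T N (suc x) (suc y)))) (ℚₚ.*-identityˡ t))
  rearrange : ∀ h s t → 1ℚ - (h - s * t) ≡ (1ℚ - h) + s * t
  rearrange = solve-∀ ℚ-ring
  halve : ∀ p S → (1ℚ - p) * S + ½ * p * S ≡ (1ℚ - ½ * p) * S
  halve = solve-∀ ℚ-ring

∣1-H-interior∣≤ : ∀ N x y → ∣ 1ℚ - H N (suc x) (suc y) ∣ ≤ ½ ^ℚ x + ½ ^ℚ y
∣1-H-interior∣≤ N x y = begin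
  ∣ 1ℚ - H N (suc x) (suc y) ∣     ≤⟨ 1-H-interior≤ N x y ⟩
  (1ℚ - p) * S                     ≡⟨ ℚₚ.+-identityʳ _ ⟨
  (1ℚ - p) * S + 0ℚ                ≤⟨ ℚₚ.+-monoʳ-≤ ((1ℚ - p) * S) (0≤p*q (0≤p^n 0≤½ N) 0≤S) ⟩
  (1ℚ - p) * S + p * S             ≡⟨ recombine p S ⟩
  S                                ∎
  where
  open ℚₚ.≤-Reasoning
  p = ½ ^ℚ N
  S = ½ ^ℚ x + ½ ^ℚ y
  0≤S = 0≤p+q (0≤p^n 0≤½ x) (0≤p^n 0≤½ y)
  recombine : ∀ p S → (1ℚ - p) * S + p * S ≡ S
  recombine = solve-∀ ℚ-ring

sq-perturb : ∀ {a d M e} → a * a ≤ M → ∣ d ∣ ≤ e → e ≤ 1ℚ → (a - d) * (a - d) ≤ M + e * (ℕ→ℚ 2 + M)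
sq-perturb {a} {d} {M} {e} a²≤M ∣d∣≤e e≤1 = begin
  (a - d) * (a - d)
                                      ≤⟨ *-self-mono-≤ (ℚₚ.≤-trans (ℚₚ.∣p-q∣≤∣p∣+∣q∣ a d) (ℚₚ.+-monoʳ-≤ ∣ a ∣ ∣d∣≤e)) ⟩
  (∣ a ∣ + e) * (∣ a ∣ + e)           ≡⟨ expand ∣ a ∣ e ⟩
  ∣ a ∣ * ∣ a ∣ + e * (∣ a ∣ + ∣ a ∣ + e)
                                      ≤⟨ ℚₚ.+-mono-≤ ∣a∣²≤M (*-monoˡ-≤-0≤ 0≤e (ℚₚ.+-mono-≤ 2∣a∣≤1+M e≤1)) ⟩
  M + e * (1ℚ + M + 1ℚ)               ≡⟨ cong (λ z → M + e * z) (solve (M ∷ []) ℚ-ring) ⟩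
  M + e * (ℕ→ℚ 2 + M)                 ∎
  where
  open ℚₚ.≤-Reasoning
  0≤e = ℚₚ.≤-trans (ℚₚ.0≤∣p∣ d) ∣d∣≤e
  ∣a∣²≤M : ∣ a ∣ * ∣ a ∣ ≤ M
  ∣a∣²≤M = subst (_≤ M) (p*p≡∣p∣*∣p∣ a) a²≤M
  2∣a∣≤1+M : ∣ a ∣ + ∣ a ∣ ≤ 1ℚ + M
  2∣a∣≤1+M = begin
    ∣ a ∣ + ∣ a ∣                 ≡⟨ cong₂ _+_ (ℚₚ.*-identityʳ ∣ a ∣) (ℚₚ.*-identityʳ ∣ a ∣) ⟨
    ∣ a ∣ * 1ℚ + ∣ a ∣ * 1ℚ       ≤⟨ 2pq≤p²+q² ∣ a ∣ 1ℚ ⟩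
    ∣ a ∣ * ∣ a ∣ + 1ℚ            ≤⟨ ℚₚ.+-monoˡ-≤ 1ℚ ∣a∣²≤M ⟩
    M + 1ℚ                        ≡⟨ ℚₚ.+-comm M 1ℚ ⟩
    1ℚ + M                        ∎
  expand : ∀ A e → (A + e) * (A + e) ≡ A * A + e * (A + A + e)
  expand = solve-∀ ℚ-ring

c-decomposition : ∀ n N → let g = λ x y → H N (suc x) (suc y) in
  ℕ→ℚ (c n) - ℕ→ℚ (3 ^ n) * αPartial N
    ≡ walkSum n (λ x y → 1ℚ - g x y) 0 0 - (ℕ→ℚ (3 ^ n) * g 0 0 - walkSum n g 0 0)
c-decomposition n N = begin
  ℕ→ℚ (c n) - ℕ→ℚ (3 ^ n) * αPartial N
    ≡⟨ cong₂ (λ w α → w - ℕ→ℚ (3 ^ n) * α) (c≡walkSum n) (αPartial≡H N) ⟩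
  walkSum n (λ _ _ → 1ℚ) 0 0 - ℕ→ℚ (3 ^ n) * H N 1 1
    ≡⟨ regroup (walkSum n (λ _ _ → 1ℚ) 0 0) (walkSum n g 0 0) (ℕ→ℚ (3 ^ n) * H N 1 1) ⟩
  (walkSum n (λ _ _ → 1ℚ) 0 0 - walkSum n g 0 0) - (ℕ→ℚ (3 ^ n) * H N 1 1 - walkSum n g 0 0)
    ≡⟨ cong (_- (ℕ→ℚ (3 ^ n) * H N 1 1 - walkSum n g 0 0)) (walkSum-- n (λ _ _ → 1ℚ) g 0 0) ⟨
  walkSum n (λ x y → 1ℚ - g x y) 0 0 - (ℕ→ℚ (3 ^ n) * H N 1 1 - walkSum n g 0 0) ∎
  where
  open ≡-Reasoning
  g = λ x y → H N (suc x) (suc y)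
  regroup : ∀ w₁ w t → w₁ - t ≡ (w₁ - w) - (t - w)
  regroup = solve-∀ ℚ-ring

walkSum-1-H-sq≤ : ∀ n N → let A = walkSum n (λ x y → 1ℚ - H N (suc x) (suc y)) 0 0 in
                  A * A ≤ ℕ→ℚ (2 ℕ.* 2 ℕ.* 8 ^ n)
walkSum-1-H-sq≤ n N = begin
  A * A                        ≤⟨ *-self-mono-≤ ∣A∣≤s+s ⟩
  (s + s) * (s + s)            ≡⟨ four-s² s ⟩
  ℕ→ℚ 4 * (s * s)              ≤⟨ *-monoˡ-≤-0≤ (0≤ℕ→ℚ 4) (walkSum-½^y-sq≤ n 0 0) ⟩
  ℕ→ℚ 4 * (ℕ→ℚ (8 ^ n) * 1ℚ)   ≡⟨ cong (ℕ→ℚ 4 *_) (ℚₚ.*-identityʳ (ℕ→ℚ (8 ^ n))) ⟩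
  ℕ→ℚ 4 * ℕ→ℚ (8 ^ n)          ≡⟨ ℕ→ℚ-* 4 (8 ^ n) ⟨
  ℕ→ℚ (2 ℕ.* 2 ℕ.* 8 ^ n)      ∎
  where
  open ℚₚ.≤-Reasoning
  A = walkSum n (λ x y → 1ℚ - H N (suc x) (suc y)) 0 0
  s = walkSum n (λ _ b → ½ ^ℚ b) 0 0
  ∣A∣≤s+s : ∣ A ∣ ≤ s + s
  ∣A∣≤s+s = begin
    ∣ A ∣                                            ≤⟨ walkSum-abs (∣1-H-interior∣≤ N) n 0 0 ⟩
    walkSum n (λ x y → ½ ^ℚ x + ½ ^ℚ y) 0 0         ≡⟨ walkSum-+ n (λ a _ → ½ ^ℚ a) (λ _ b → ½ ^ℚ b) 0 0 ⟩
    walkSum n (λ a _ → ½ ^ℚ a) 0 0 + s              ≡⟨ cong (_+ s) (walkSum-flip n (λ _ b → ½ ^ℚ b) 0 0) ⟩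
    s + s                                            ∎
  four-s² : ∀ s → (s + s) * (s + s) ≡ ℕ→ℚ 4 * (s * s)
  four-s² = solve-∀ ℚ-ring

harmonic-part-error : ∀ n N → ∣ ℕ→ℚ (3 ^ n) * H N 1 1 - walkSum n (λ x y → H N (suc x) (suc y)) 0 0 ∣
                              ≤ ℕ→ℚ (3 ^ n) * P N
harmonic-part-error n N = walkSum-harmonic {H N} (harmonic-H N) (∣H-boundary∣≤P N) ∣H-boundary′∣≤P n 0 0
  where
  ∣H-boundary′∣≤P : ∀ j → ∣ H N 0 (suc j) ∣ ≤ P N
  ∣H-boundary′∣≤P j = subst (λ h → ∣ h ∣ ≤ P N) (H-sym N (suc j) 0) (∣H-boundary∣≤P N j)

archimedean : ∀ ε → 0ℚ < ε → ∃[ q ] 1ℚ ≤ ℕ→ℚ (suc q) * ε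
archimedean (mkℚ (ℤ.+ zero) _ _)  (Data.Rational.*<* (ℤ.+<+ ()))
archimedean (mkℚ ℤ.-[1+ _ ] _ _)  (Data.Rational.*<* ())
archimedean ε@(mkℚ (ℤ.+ suc p) d _) _ = d , (begin
  1ℚ                                    ≤⟨ ℕ→ℚ-mono-≤ {1} {suc p} (ℕ.s≤s ℕ.z≤n) ⟩
  ℕ→ℚ (suc p)                           ≡⟨ i/d*d≡i/1 (ℤ.+ suc p) (suc d) ⟨
  (ℤ.+ suc p / suc d) * ℕ→ℚ (suc d)     ≡⟨ cong (_* ℕ→ℚ (suc d)) (ℚₚ.↥p/↧p≡p ε) ⟩
  ε * ℕ→ℚ (suc d)                       ≡⟨ ℚₚ.*-comm ε (ℕ→ℚ (suc d)) ⟩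
  ℕ→ℚ (suc d) * ε                       ∎)
  where open ℚₚ.≤-Reasoning

P-eventually-below : ∀ K ε → 0ℚ < ε → ∃[ N₀ ] K ℕ.≤ N₀ × (∀ N → N₀ ℕ.≤ N → ℕ→ℚ K * P N ≤ ε)
P-eventually-below K ε 0<ε with archimedean ε 0<ε
... | q , 1≤qε = K ℕ.* suc q , ℕₚ.m≤m*n K (suc q) , λ N N₀≤N →
  ℚₚ.*-cancelˡ-≤-pos (ℕ→ℚ (suc q)) {{ℚₚ.normalize-pos (suc q) 1}} (begin
    ℕ→ℚ (suc q) * (ℕ→ℚ K * P N)      ≡⟨ ℚₚ.*-assoc (ℕ→ℚ (suc q)) (ℕ→ℚ K) (P N) ⟨
    ℕ→ℚ (suc q) * ℕ→ℚ K * P N        ≡⟨ cong (_* P N) (trans (ℚₚ.*-comm (ℕ→ℚ (suc q)) (ℕ→ℚ K)) (sym (ℕ→ℚ-* K (suc q)))) ⟩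
    ℕ→ℚ (K ℕ.* suc q) * P N          ≤⟨ ℕ→ℚ-*P≤1 N₀≤N ⟩
    1ℚ                               ≤⟨ 1≤qε ⟩
    ℕ→ℚ (suc q) * ε                  ∎)
  where open ℚₚ.≤-Reasoning

error-factor : ℕ → ℕ
error-factor n = 3 ^ n ℕ.* (2 ℕ.+ 2 ℕ.* 2 ℕ.* 8 ^ n)

estimate : ∀ n N → ℕ→ℚ (3 ^ n) * P N ≤ 1ℚ →
  (ℕ→ℚ (c n) - ℕ→ℚ (3 ^ n) * αPartial N) * (ℕ→ℚ (c n) - ℕ→ℚ (3 ^ n) * αPartial N)
    ≤ ℕ→ℚ (2 ℕ.* 2 ℕ.* 8 ^ n) + ℕ→ℚ (error-factor n) * P N
estimate n N 3ⁿP≤1 = begin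
  (ℕ→ℚ (c n) - ℕ→ℚ (3 ^ n) * αPartial N) * (ℕ→ℚ (c n) - ℕ→ℚ (3 ^ n) * αPartial N)
    ≡⟨ cong (λ t → t * t) (c-decomposition n N) ⟩
  (A - E) * (A - E)
    ≤⟨ sq-perturb {A} (walkSum-1-H-sq≤ n N) (harmonic-part-error n N) 3ⁿP≤1 ⟩
  M + ℕ→ℚ (3 ^ n) * P N * (ℕ→ℚ 2 + M)       ≡⟨ cong (M +_) (swap (ℕ→ℚ (3 ^ n)) (P N) (ℕ→ℚ 2 + M)) ⟩
  M + ℕ→ℚ (3 ^ n) * (ℕ→ℚ 2 + M) * P N       ≡⟨ cong (λ k → M + ℕ→ℚ (3 ^ n) * k * P N) (ℕ→ℚ-+ 2 m) ⟨
  M + ℕ→ℚ (3 ^ n) * ℕ→ℚ (2 ℕ.+ m) * P N     ≡⟨ cong (λ k → M + k * P N) (ℕ→ℚ-* (3 ^ n) (2 ℕ.+ m)) ⟨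
  M + ℕ→ℚ (error-factor n) * P N            ∎
  where
  open ℚₚ.≤-Reasoning
  m = 2 ℕ.* 2 ℕ.* 8 ^ n
  M = ℕ→ℚ m
  A = walkSum n (λ x y → 1ℚ - H N (suc x) (suc y)) 0 0
  E = ℕ→ℚ (3 ^ n) * H N 1 1 - walkSum n (λ x y → H N (suc x) (suc y)) 0 0
  swap : ∀ a p b → a * p * b ≡ a * b * p
  swap = solve-∀ ℚ-ring

corollary1 : ∃[ C ] ∀ (n : ℕ) (ε : ℚ) → 0ℚ < ε →
               ∃[ N₀ ] ∀ (N : ℕ) → N₀ ℕ.≤ N →
                 (ℕ→ℚ (c n) - ℕ→ℚ (3 ^ n) * αPartial N) * (ℕ→ℚ (c n) - ℕ→ℚ (3 ^ n) * αPartial N)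
                   ≤ ℕ→ℚ (C ℕ.* C ℕ.* 8 ^ n) + ε
corollary1 = 2 , λ n ε 0<ε →
  let (N₀ , K≤N₀ , KP≤ε) = P-eventually-below (error-factor n) ε 0<ε in
  N₀ , λ N N₀≤N →
    let 3ⁿ≤N = ℕₚ.≤-trans (ℕₚ.m≤m*n (3 ^ n) (2 ℕ.+ 2 ℕ.* 2 ℕ.* 8 ^ n)) (ℕₚ.≤-trans K≤N₀ N₀≤N) in
    ℚₚ.≤-trans (estimate n N (ℕ→ℚ-*P≤1 3ⁿ≤N)) (ℚₚ.+-monoʳ-≤ (ℕ→ℚ (2 ℕ.* 2 ℕ.* 8 ^ n)) (KP≤ε N N₀≤N))
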